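{- For every positive integer $t$ and every graph $G$, $ch'_t(G)\le \left\lceil \frac{ch'(G)}{t}\right\rceil$.
   Context: Graphs are finite, undirected and simple. A list assignment $L=(L(e):e\in E(G))$ assigns a set of colors to each edge; $|L|=\min_e|L(e)|$. An $L$-coloring is a map $\phi$ on $E(G)$ with $\phi(e)\in L(e)$ such that each color class $\phi^{ -1}(c)$ is a matching; the list chromatic index $ch'(G)$ is the minimum $k$ such that $G$ has an $L$-coloring for every list assignment $L$ with $|L|\ge k$. A degree $t$ $L$-coloring is a map $\phi$ on $E(G)$ with $\phi(e)\in L(e)$ such that every monochromatic subgraph (the subgraph formed by $\phi^{ -1}(c)$ for a color $c$) has maximum degree at most $t$; $ch'_t(G)$ is the minimum $k$ such that $G$ has a degree $t$ $L$-coloring for every list assignment $L$ with $|L|\ge k$. -}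

module Defs where

open import Data.Nat using (ℕ; _≤_; _<_; _+_; _∸_; NonZero)
open import Data.Nat.DivMod using (_/_)
open import Data.Fin using (Fin) renaming (_<_ to _<ᶠ_)
open import Data.Bool using (Bool; true)
open import Data.Product using (Σ; Σ-syntax; _×_; proj₁; proj₂)
open import Data.Sum using (_⊎_)
open import Data.List using (List; length)
open import Data.List.Relation.Unary.All using (All)
open import Data.List.Relation.Unary.Unique.Propositional using (Unique)
open import Data.List.Membership.Propositional using (_∈_)
open import Relation.Binary.PropositionalEquality using (_≡_; _≢_)
open import Relation.Nullary using (¬_)

record Graph : Set where
  field
    n     : ℕ
    adj   : Fin n → Fin n → Bool
    sym   : ∀ u v → adj u v ≡ adj v u
    irrefl : ∀ u → adj u u ≡ Bool.false
open Graph public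

-- An edge {u,v} represented canonically with u < v.
Edge : Graph → Set
Edge G = Σ[ u ∈ Fin (n G) ] Σ[ v ∈ Fin (n G) ] (u <ᶠ v × adj G u v ≡ true)

Incident : (G : Graph) → Fin (n G) → Edge G → Set
Incident G x e = proj₁ e ≡ x ⊎ proj₁ (proj₂ e) ≡ x

ListAssignment : Graph → Set
ListAssignment G = Edge G → List ℕ

HasSizeAtLeast : (G : Graph) → ListAssignment G → ℕ → Set
HasSizeAtLeast G L k = ∀ e → Unique (L e) × k ≤ length (L e)

IsLColoring : (G : Graph) → ListAssignment G → (Edge G → ℕ) → Set
IsLColoring G L φ =
  (∀ e → φ e ∈ L e) ×
  (∀ e f x → e ≢ f → Incident G x e → Incident G x f → φ e ≢ φ f)

-- a degree t L-colouring: each monochromatic subgraph has max degree ≤ t,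
-- i.e. any duplicate-free list of edges at a vertex x of colour c has length ≤ t
IsDegreeLColoring : (G : Graph) → ℕ → ListAssignment G → (Edge G → ℕ) → Set
IsDegreeLColoring G t L φ =
  (∀ e → φ e ∈ L e) ×
  (∀ (x : Fin (n G)) (c : ℕ) (es : List (Edge G)) → Unique es →
     All (λ e → Incident G x e × φ e ≡ c) es → length es ≤ t)

EdgeChoosable : Graph → ℕ → Set
EdgeChoosable G k = ∀ (L : ListAssignment G) → HasSizeAtLeast G L k →
  Σ[ φ ∈ (Edge G → ℕ) ] IsLColoring G L φ

DegreeEdgeChoosable : Graph → ℕ → ℕ → Set
DegreeEdgeChoosable G t k = ∀ (L : ListAssignment G) → HasSizeAtLeast G L k →
  Σ[ φ ∈ (Edge G → ℕ) ] IsDegreeLColoring G t L φ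

IsListChromaticIndex : Graph → ℕ → Set
IsListChromaticIndex G k = EdgeChoosable G k × (∀ j → j < k → ¬ EdgeChoosable G j)

IsDegreeListChromaticIndex : Graph → ℕ → ℕ → Set
IsDegreeListChromaticIndex G t k =
  DegreeEdgeChoosable G t k × (∀ j → j < k → ¬ DegreeEdgeChoosable G t j)

ceilDiv : (k t : ℕ) → .{{NonZero t}} → ℕ
ceilDiv k t = (k + (t ∸ 1)) / t

-- Give each colour c the t copies c·t, c·t + 1, …, c·t + (t − 1); lists of size ⌈k/t⌉ become
-- lists of size at least k, so an ordinary list edge-colouring ψ from the expanded lists exists.
-- Forgetting the copy, φ e = ψ e / t, lies in the original lists, and the edges of one colour
-- at a vertex carry pairwise different copies ψ e mod t, so there are at most t of them.
module Submission where

open import Defs hiding (sym)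
open import Data.Nat using (ℕ; NonZero; _+_; _*_; _∸_; _≤_; s≤s; _≤?_)
open import Data.Nat.Properties
open import Data.Nat.DivMod
open import Data.Nat.Divisibility using (n∣m*n)
open import Data.Fin using (Fin; toℕ) renaming (zero to fzero; suc to fsuc; _<_ to _<ᶠ_)
open import Data.Fin.Properties using (toℕ-injective; toℕ-fromℕ<; toℕ<n; pigeonhole)
open import Data.Product using (_,_; _×_; proj₁; proj₂; map₂)
open import Data.List using (List; []; _∷_; _++_; length; lookup; map; allFin; cartesianProductWith)
open import Data.List.Properties using (length-++; length-map; length-tabulate)
open import Data.List.Relation.Unary.All as All using (All)
open import Data.List.Relation.Unary.AllPairs using (_∷_)
open import Data.List.Relation.Unary.Unique.Propositional using (Unique)
open import Data.List.Relation.Unary.Unique.Propositional.Properties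
  using (cartesianProductWith⁺; allFin⁺)
open import Data.List.Membership.Propositional using (_∈_)
open import Data.List.Membership.Propositional.Properties using (∈-lookup; ∈-cartesianProductWith⁻)
open import Function using (_∘_)
open import Relation.Binary.PropositionalEquality
open import Relation.Nullary using (yes; no; contradiction)

module _ {A : Set} where

  lookup-distinct : ∀ {xs : List A} → Unique xs → {i j : Fin (length xs)} →
    i <ᶠ j → lookup xs i ≢ lookup xs j
  lookup-distinct {_ ∷ _} (x∉xs ∷ _) {fzero} {fsuc j} _ = All.lookup x∉xs (∈-lookup j)
  lookup-distinct {_ ∷ _} (_ ∷ u) {fsuc i} {fsuc j} (s≤s i<j) = lookup-distinct u i<j

  -- Phrased with ≢ rather than injectivity, so no decidable equality on A is needed.
  length≤-separatedBy : ∀ {P : A → Set} {m} (f : A → Fin m) →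
    (∀ {a b} → P a → P b → a ≢ b → f a ≢ f b) →
    ∀ {xs} → Unique xs → All P xs → length xs ≤ m
  length≤-separatedBy {m = m} f separates {xs} u ps with length xs ≤? m
  ... | yes ≤m = ≤m
  ... | no ≰m with i , j , i<j , fi≡fj ← pigeonhole (≰⇒> ≰m) (f ∘ lookup xs) =
    contradiction fi≡fj
      (separates (All.lookup ps (∈-lookup i)) (All.lookup ps (∈-lookup j)) (lookup-distinct u i<j))

length-cartesianProductWith : ∀ {A B C : Set} (f : A → B → C) xs ys →
  length (cartesianProductWith f xs ys) ≡ length xs * length ys
length-cartesianProductWith f [] ys = refl
length-cartesianProductWith f (x ∷ xs) ys = begin
  length (map (f x) ys ++ cartesianProductWith f xs ys)
    ≡⟨ length-++ (map (f x) ys) ⟩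
  length (map (f x) ys) + length (cartesianProductWith f xs ys)
    ≡⟨ cong₂ _+_ (length-map (f x) ys) (length-cartesianProductWith f xs ys) ⟩
  length ys + length xs * length ys ∎
  where open ≡-Reasoning

module Copies (t : ℕ) .{{_ : NonZero t}} where

  copy : ℕ → Fin t → ℕ
  copy c i = toℕ i + c * t

  copy-/ : ∀ c i → copy c i / t ≡ c
  copy-/ c i = begin
    (toℕ i + c * t) / t     ≡⟨ +-distrib-/-∣ʳ (toℕ i) (n∣m*n c) ⟩
    toℕ i / t + c * t / t   ≡⟨ cong₂ _+_ (m<n⇒m/n≡0 (toℕ<n i)) (m*n/n≡m c t) ⟩
    c                       ∎
    where open ≡-Reasoning

  copy-mod : ∀ c i → copy c i mod t ≡ i
  copy-mod c i = toℕ-injective (begin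
    toℕ (copy c i mod t)    ≡⟨ toℕ-fromℕ< (m%n<n (copy c i) t) ⟩
    (toℕ i + c * t) % t     ≡⟨ [m+kn]%n≡m%n (toℕ i) c t ⟩
    toℕ i % t               ≡⟨ m<n⇒m%n≡m (toℕ<n i) ⟩
    toℕ i                   ∎)
    where open ≡-Reasoning

  copy-injective : ∀ {c d i j} → copy c i ≡ copy d j → c ≡ d × i ≡ j
  copy-injective {c} {d} {i} {j} eq =
    trans (sym (copy-/ c i)) (trans (cong (_/ t) eq) (copy-/ d j)) ,
    trans (sym (copy-mod c i)) (trans (cong (_mod t) eq) (copy-mod d j))

  /-mod-injective : ∀ {m n} → m / t ≡ n / t → m mod t ≡ n mod t → m ≡ n
  /-mod-injective {m} {n} m/t≡n/t m%t≡n%t = begin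
    m                               ≡⟨ DivMod.property (m divMod t) ⟩
    toℕ (m mod t) + m / t * t       ≡⟨ cong₂ (λ r q → toℕ r + q * t) m%t≡n%t m/t≡n/t ⟩
    toℕ (n mod t) + n / t * t       ≡⟨ DivMod.property (n divMod t) ⟨
    n                               ∎
    where open ≡-Reasoning

  copies : List ℕ → List ℕ
  copies cs = cartesianProductWith copy cs (allFin t)

  copies-unique : ∀ {cs} → Unique cs → Unique (copies cs)
  copies-unique u = cartesianProductWith⁺ copy copy-injective u (allFin⁺ t)

  length-copies : ∀ cs → length (copies cs) ≡ length cs * t
  length-copies cs = trans (length-cartesianProductWith copy cs (allFin t))
    (cong (length cs *_) (length-tabulate (λ i → i)))

  ∈-copies⁻ : ∀ {m} cs → m ∈ copies cs → m / t ∈ cs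
  ∈-copies⁻ cs m∈ with c , i , c∈cs , _ , refl ← ∈-cartesianProductWith⁻ copy cs (allFin t) m∈ =
    subst (_∈ cs) (sym (copy-/ c i)) c∈cs

  ≤-ceilDiv* : ∀ k → k ≤ ceilDiv k t * t
  ≤-ceilDiv* k = +-cancelʳ-≤ (t ∸ 1) k _ (begin
    k + (t ∸ 1)           ≡⟨ m≡m%n+[m/n]*n m t ⟩
    m % t + m / t * t     ≤⟨ +-monoˡ-≤ _ (suc[m]≤n⇒m≤pred[n] (m%n<n m t)) ⟩
    (t ∸ 1) + m / t * t   ≡⟨ +-comm (t ∸ 1) _ ⟩
    m / t * t + (t ∸ 1)   ∎)
    where
    m = k + (t ∸ 1)
    open ≤-Reasoning

EdgeChoosable-mono : ∀ G {j k} → j ≤ k → EdgeChoosable G j → EdgeChoosable G k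
EdgeChoosable-mono G j≤k choosable L size = choosable L (map₂ (≤-trans j≤k) ∘ size)

module _ (t : ℕ) .{{_ : NonZero t}} (G : Graph) where
  open Copies t

  copies-HasSizeAtLeast : ∀ {L s} → HasSizeAtLeast G L s → HasSizeAtLeast G (copies ∘ L) (s * t)
  copies-HasSizeAtLeast {L} size e =
    copies-unique (proj₁ (size e)) ,
    subst (_ ≤_) (sym (length-copies (L e))) (*-monoˡ-≤ t (proj₂ (size e)))

  IsLColoring-copies⇒IsDegreeLColoring : ∀ {L ψ} → IsLColoring G (copies ∘ L) ψ →
    IsDegreeLColoring G t L (λ e → ψ e / t)
  IsLColoring-copies⇒IsDegreeLColoring {L} {ψ} (ψ∈L , proper) =
    (λ e → ∈-copies⁻ (L e) (ψ∈L e)) ,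
    (λ x c _ u → length≤-separatedBy (λ e → ψ e mod t) (copy-separates x c) u)
    where
    copy-separates : ∀ x c {a b} → Incident G x a × ψ a / t ≡ c → Incident G x b × ψ b / t ≡ c →
      a ≢ b → ψ a mod t ≢ ψ b mod t
    copy-separates x c {a} {b} (x∈a , ψa≡c) (x∈b , ψb≡c) a≢b =
      proper a b x a≢b x∈a x∈b ∘ /-mod-injective (trans ψa≡c (sym ψb≡c))

  EdgeChoosable⇒DegreeEdgeChoosable : ∀ s → EdgeChoosable G (s * t) → DegreeEdgeChoosable G t s
  EdgeChoosable⇒DegreeEdgeChoosable s choosable L size
    with ψ , ψ-colouring ← choosable (copies ∘ L) (copies-HasSizeAtLeast size) =
    (λ e → ψ e / t) , IsLColoring-copies⇒IsDegreeLColoring ψ-colouring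

proposition1p5 : (t : ℕ) → .{{_ : NonZero t}} → (G : Graph) → (k : ℕ) →
    IsListChromaticIndex G k →
    DegreeEdgeChoosable G t (ceilDiv k t)
proposition1p5 t G k (choosable , _) =
  EdgeChoosable⇒DegreeEdgeChoosable t G (ceilDiv k t)
    (EdgeChoosable-mono G (Copies.≤-ceilDiv* t k) choosable)
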